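{- For every integer $k\ge 0$, there exists a bijection between $\mathcal{U}_{2k+1}(132,312)$ and $\mathcal{D}_k$, the set of Dyck paths of semilength $k$. In particular, $|\mathcal{U}_{2k+1}(132,312)|=\frac{1}{k+1}\binom{2k}{k}$.
   Context: West's stack-sorting map $s$ is defined recursively on finite sequences of distinct positive integers: $s$ sends the empty sequence to itself, and if $\pi$ is a nonempty such sequence with largest entry $n$, writing $\pi=LnR$ one sets $s(\pi)=s(L)s(R)n$. A permutation $\pi\in S_n$ (written in one-line notation) is uniquely sorted if exactly one permutation $\sigma\in S_n$ satisfies $s(\sigma)=\pi$. Let $\mathcal{U}_n$ be the set of uniquely sorted permutations in $S_n$. A permutation $\pi$ contains a pattern $\tau\in S_m$ if some subsequence of $\pi$ of length $m$ has its entries in the same relative order as $\tau$; otherwise $\pi$ avoids $\tau$. $\mathcal{U}_{n}(\tau^{(1)},\dots,\tau^{(\ell)})$ denotes the set of permutations in $\mathcal{U}_n$ avoiding all of $\tau^{(1)},\dots,\tau^{(\ell)}$. A Dyck path of semilength $k$ is a lattice path from $(0,0)$ to $(2k,0)$ with $k$ steps $(1,1)$ and $k$ steps $(1,-1)$ never going below the horizontal axis. -}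

module Defs where

open import Level using (0ℓ)
open import Data.Nat using (ℕ; zero; suc; _+_; _*_; _<_; _≤_; _≥_)
open import Data.Nat.Combinatorics using (_C_)
open import Data.Nat.DivMod using (_/_)
open import Data.List using (List; []; _∷_; _++_; [_]; length)
open import Data.List.Relation.Binary.Sublist.Propositional using (_⊆_)
open import Data.List.Relation.Binary.Pointwise using (Pointwise)
open import Data.List.Relation.Unary.Unique.Propositional using (Unique)
open import Data.List.Membership.Propositional using (_∈_)
open import Data.Product using (Σ; ∃; _×_; _,_; proj₁)
open import Data.Unit using (⊤)
open import Data.Empty using (⊥)
open import Data.Fin using (Fin)
open import Function.Bundles using (_⇔_; Bijection)
open import Relation.Binary.Bundles using (Setoid)
open import Relation.Binary.PropositionalEquality using (_≡_; refl; sym; trans)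
open import Relation.Nullary using (¬_)

-- Permutations of [n] in one-line notation: lists of length n whose
-- entries are distinct and lie in {1,…,n}.

IsPerm : ℕ → List ℕ → Set
IsPerm n π = length π ≡ n × Unique π × (∀ x → x ∈ π → 1 ≤ x × x ≤ n)

-- West's stack-sorting map s(LnR) = s(L) s(R) n.

maxL : List ℕ → ℕ
maxL [] = 0
maxL (x ∷ xs) = Data.Nat._⊔_ x (maxL xs)

splitAt : ℕ → List ℕ → List ℕ × List ℕ
splitAt m [] = [] , []
splitAt m (x ∷ xs) with Data.Nat._≟_ x m
... | Relation.Nullary.yes _ = [] , xs
... | Relation.Nullary.no _ with splitAt m xs
...   | (L , R) = x ∷ L , R

-- fuel-bounded version; fuel = length suffices since L, R are shorter
sFuel : ℕ → List ℕ → List ℕ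
sFuel zero xs = []
sFuel (suc f) [] = []
sFuel (suc f) (x ∷ xs) with splitAt (maxL (x ∷ xs)) (x ∷ xs)
... | (L , R) = sFuel f L ++ sFuel f R ++ [ maxL (x ∷ xs) ]

stackSort : List ℕ → List ℕ
stackSort xs = sFuel (length xs) xs

UniquelySorted : ℕ → List ℕ → Set
UniquelySorted n π =
  IsPerm n π ×
  Σ (List ℕ) λ σ → (IsPerm n σ × stackSort σ ≡ π) ×
    (∀ τ → IsPerm n τ → stackSort τ ≡ π → τ ≡ σ)

-- Pattern containment (for sequences of distinct entries).

SameOrder : List ℕ → List ℕ → Set
SameOrder [] [] = ⊤
SameOrder [] (_ ∷ _) = ⊥
SameOrder (_ ∷ _) [] = ⊥
SameOrder (x ∷ xs) (y ∷ ys) =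
  Pointwise (λ a b → (x < a ⇔ y < b)) xs ys × SameOrder xs ys

Contains : List ℕ → List ℕ → Set
Contains π τ = Σ (List ℕ) λ xs → xs ⊆ π × SameOrder xs τ

Avoids : List ℕ → List ℕ → Set
Avoids π τ = ¬ Contains π τ

U-132-312 : ℕ → List ℕ → Set
U-132-312 n π =
  UniquelySorted n π × Avoids π (1 ∷ 3 ∷ 2 ∷ []) × Avoids π (3 ∷ 1 ∷ 2 ∷ [])

data Step : Set where
  U D : Step

ValidFrom : ℕ → List Step → Set
ValidFrom h [] = h ≡ 0
ValidFrom h (U ∷ p) = ValidFrom (suc h) p
ValidFrom zero (D ∷ p) = ⊥
ValidFrom (suc h) (D ∷ p) = ValidFrom h p

IsDyck : ℕ → List Step → Set
IsDyck k p = length p ≡ 2 * k × ValidFrom 0 p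

SubsetSetoid : {A : Set} → (A → Set) → Setoid 0ℓ 0ℓ
SubsetSetoid {A} P = record
  { Carrier = Σ A P
  ; _≈_ = λ x y → proj₁ x ≡ proj₁ y
  ; isEquivalence = record { refl = refl ; sym = sym ; trans = trans }
  }

U132-312-Setoid : ℕ → Setoid 0ℓ 0ℓ
U132-312-Setoid n = SubsetSetoid (U-132-312 n)

DyckSetoid : ℕ → Setoid 0ℓ 0ℓ
DyckSetoid k = SubsetSetoid (IsDyck k)

FinSetoid : ℕ → Setoid 0ℓ 0ℓ
FinSetoid m = Relation.Binary.PropositionalEquality.setoid (Fin m)

catalan : ℕ → ℕ
catalan k = ((2 * k) C k) / suc k

-- Read a sequence as a lattice path, a descent being an up step and an ascent a down step. A
-- permutation avoids 132 and 312 exactly when each of its entries is larger or smaller than all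
-- earlier ones, and such an extremal permutation is determined by its path. For every σ the path
-- of s(σ), started at a suitable height, ends at height 0 without going below it, by induction
-- along s(LnR) = s(L) s(R) n. Conversely, if the path of an extremal π runs from height h to 0,
-- then π has exactly one preimage when h = 0 and at least two otherwise: the last entry n is the
-- maximum, and either the rest of the path stays above 0, so that n may come first or last in a
-- preimage, or every preimage L n R must cut at the last return of the path to 0. Hence π ↦ its
-- path is a bijection onto Dyck paths, whose number follows from the reflection principle.

module Submission where

open import Defs
open import Data.Empty using (⊥; ⊥-elim)
open import Data.Unit using (⊤; tt)
open import Data.Product using (Σ; ∃; ∃₂; _×_; _,_; proj₁; proj₂)
import Data.Product as Product
open import Data.Sum using (_⊎_; inj₁; inj₂)
import Data.Sum as Sum
open import Function.Base using (_∘_)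
open import Function.Bundles using (_⇔_; mk⇔; Equivalence; Bijection)
open import Function.Construct.Composition using () renaming (bijection to _∘-bijection_)
open import Relation.Nullary using (¬_; yes; no)
open import Relation.Binary.PropositionalEquality
  using (_≡_; _≢_; ≢-sym; refl; sym; trans; cong; cong₂; subst; setoid; module ≡-Reasoning)

open import Data.Nat using (ℕ; zero; suc; pred; _+_; _*_; _∸_; _!; _≤_; _<_; z≤n; s≤s; _≟_; _<?_)
open import Data.Nat.Properties
open import Data.Nat.Combinatorics
  using (_C_; nCk≡n!/k![n-k]!; k![n∸k]!∣n!; nCk≡nC[n∸k]; nCk+nC[k+1]≡[n+1]C[k+1])
open import Data.Nat.DivMod using (_/_; m/n*n≡m; m*n/n≡m)
open import Data.Nat.Solver using (module +-*-Solver)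
open import Algebra.Properties.CommutativeSemigroup +-commutativeSemigroup using (interchange)
open import Data.Fin using (Fin; _↑ˡ_; _↑ʳ_) renaming (splitAt to splitFin)
open import Data.Fin.Properties using (splitAt-↑ˡ; splitAt-↑ʳ; splitAt⁻¹-↑ˡ; splitAt⁻¹-↑ʳ)

open import Data.List using (List; []; _∷_; _++_; [_]; length; _∷ʳ_; applyUpTo; replicate)
open import Data.List.Properties
  using ( ++-assoc; ++-identityʳ; ++-cancelˡ; ++-cancelʳ; ++-conicalˡ; ++-conicalʳ
        ; length-++; length-applyUpTo; ∷-injective; ∷ʳ-injective)
open import Data.List.Reverse using (Reverse; reverseView; []; _∶_∶ʳ_)
open import Data.List.Membership.Propositional using (_∈_; _∉_; find)
open import Data.List.Membership.Propositional.Properties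
  using (∈-++⁺ˡ; ∈-++⁺ʳ; ∈-++⁻; ∈-∃++; ∈-applyUpTo⁺)
open import Data.List.Relation.Unary.All as All using (All; []; _∷_)
open import Data.List.Relation.Unary.All.Properties as All using ()
open import Data.List.Relation.Unary.Any using (here; there)
import Data.List.Relation.Unary.AllPairs as AllPairs
open import Data.List.Relation.Unary.Unique.Propositional using (Unique)
open import Data.List.Relation.Binary.Pointwise using ([]; _∷_)
open import Data.List.Relation.Binary.Subset.Propositional using (_⊆_)
import Data.List.Relation.Binary.Sublist.Propositional as Sublist
open Sublist using ([]; _∷_; minimum; from∈; to∈)
open import Data.List.Relation.Binary.Sublist.Propositional.Properties
  using (All-resp-⊆) renaming (++⁺ to ⊆-++⁺)
open import Data.List.Relation.Binary.Permutation.Propositional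
  using (_↭_; ↭-refl; ↭-sym; ↭-trans; ↭-reflexive; ↭⇒↭ₛ)
open import Data.List.Relation.Binary.Permutation.Propositional.Properties as ↭ using ()
open import Data.List.Relation.Binary.Permutation.Setoid.Properties (setoid ℕ) using (Unique-resp-↭)

[]≢∷ʳ : ∀ {A : Set} (y : List A) M → [] ≢ y ∷ʳ M
[]≢∷ʳ [] M ()
[]≢∷ʳ (_ ∷ _) M ()

length-split : ∀ (L : List ℕ) M R → length (L ++ M ∷ R) ≡ suc (length L + length R)
length-split L M R = trans (length-++ L) (+-suc (length L) (length R))

split-shorter : ∀ {n} L M R → length (L ++ M ∷ R) ≤ suc n → length L ≤ n × length R ≤ n
split-shorter {n} L M R ≤1+n = ≤-trans (m≤m+n _ _) |L|+|R|≤n , ≤-trans (m≤n+m _ _) |L|+|R|≤n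
  where |L|+|R|≤n = ≤-pred (subst (_≤ suc n) (length-split L M R) ≤1+n)

length-++-≤ : ∀ {n} (a : List ℕ) {b} → length (a ++ b) ≤ n → length a ≤ n × length b ≤ n
length-++-≤ a |a++b|≤n = ≤-trans (m≤m+n _ _) |a|+|b|≤n , ≤-trans (m≤n+m _ _) |a|+|b|≤n
  where |a|+|b|≤n = subst (_≤ _) (length-++ a) |a++b|≤n

++-≡-++ : ∀ {A : Set} (a b c d : List A) → a ++ b ≡ c ++ d →
  (∃ λ r → c ≡ a ++ r × b ≡ r ++ d) ⊎ (∃ λ r → a ≡ c ++ r × d ≡ r ++ b)
++-≡-++ [] b c d eq = inj₁ (c , refl , eq)
++-≡-++ (x ∷ a) b [] d eq = inj₂ (x ∷ a , refl , sym eq)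
++-≡-++ (x ∷ a) b (y ∷ c) d eq with ∷-injective eq
... | refl , eq′ = Sum.map (λ (r , c≡ , b≡) → r , cong (x ∷_) c≡ , b≡)
                           (λ (r , a≡ , d≡) → r , cong (x ∷_) a≡ , d≡) (++-≡-++ a b c d eq′)

++-cancel-length : ∀ {A : Set} (a c : List A) {b d} →
  length a ≡ length c → a ++ b ≡ c ++ d → a ≡ c
++-cancel-length [] [] _ _ = refl
++-cancel-length (x ∷ a) (y ∷ c) |a|≡|c| eq with ∷-injective eq
... | refl , eq′ = cong (x ∷_) (++-cancel-length a c (suc-injective |a|≡|c|) eq′)

∈-remove : ∀ {z x : ℕ} ys₁ {ys₂} → z ∈ ys₁ ++ x ∷ ys₂ → z ≢ x → z ∈ ys₁ ++ ys₂
∈-remove ys₁ z∈ z≢x with ∈-++⁻ ys₁ z∈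
... | inj₁ z∈ys₁ = ∈-++⁺ˡ z∈ys₁
... | inj₂ (here z≡x) = ⊥-elim (z≢x z≡x)
... | inj₂ (there z∈ys₂) = ∈-++⁺ʳ ys₁ z∈ys₂

Unique-∉ : ∀ {e : ℕ} {b} a → Unique (a ++ e ∷ b) → e ∉ a
Unique-∉ (x ∷ a) (x∉ AllPairs.∷ _) (here refl) = All.lookup x∉ (∈-++⁺ʳ a (here refl)) refl
Unique-∉ (x ∷ a) (_ AllPairs.∷ unique) (there e∈a) = Unique-∉ a unique e∈a

Unique-⊆-exhaustive : ∀ {xs ys : List ℕ} →
  Unique xs → xs ⊆ ys → length ys ≤ length xs → ys ⊆ xs
Unique-⊆-exhaustive {[]} {[]} _ _ _ ()
Unique-⊆-exhaustive {x ∷ xs} (x∉xs AllPairs.∷ unique) xs⊆ys |ys|≤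
  with ys₁ , ys₂ , refl ← ∈-∃++ (xs⊆ys (here refl)) =
  let rest : ys₁ ++ ys₂ ⊆ xs
      rest = Unique-⊆-exhaustive unique
               (λ z∈xs → ∈-remove ys₁ (xs⊆ys (there z∈xs)) (≢-sym (All.lookup x∉xs z∈xs)))
               (≤-pred (subst (_≤ suc (length xs))
                              (trans (length-split ys₁ x ys₂) (cong suc (sym (length-++ ys₁))))
                              |ys|≤))
  in λ z∈ys → Sum.[ there ∘ rest ∘ ∈-++⁺ˡ
                  , (λ { (here refl) → here refl
                       ; (there z∈ys₂) → there (rest (∈-++⁺ʳ ys₁ z∈ys₂)) }) ]
                (∈-++⁻ ys₁ z∈ys)

sublist-∷ʳ : ∀ (ys : List ℕ) {c x} → ys ∷ʳ c Sublist.⊆ x →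
  ∃₂ λ pre post → x ≡ pre ++ c ∷ post × ys Sublist.⊆ pre
sublist-∷ʳ [] c⊆x = let pre , post , x≡ = ∈-∃++ (to∈ c⊆x) in pre , post , x≡ , minimum pre
sublist-∷ʳ (y ∷ ys) (z Sublist.∷ʳ q) =
  let pre , post , x≡ , y∷ys⊆ = sublist-∷ʳ (y ∷ ys) q
  in z ∷ pre , post , cong (z ∷_) x≡ , z Sublist.∷ʳ y∷ys⊆
sublist-∷ʳ (y ∷ ys) (refl ∷ q) =
  let pre , post , x≡ , ys⊆ = sublist-∷ʳ ys q
  in y ∷ pre , post , cong (y ∷_) x≡ , refl ∷ ys⊆

∈-pair-sublist : ∀ {u w : ℕ} {a} → u ∈ a → w ∈ a → u ≢ w →
  (u ∷ w ∷ []) Sublist.⊆ a ⊎ (w ∷ u ∷ []) Sublist.⊆ a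
∈-pair-sublist (here refl) (here refl) u≢w = ⊥-elim (u≢w refl)
∈-pair-sublist (here refl) (there w∈a) _ = inj₁ (refl ∷ from∈ w∈a)
∈-pair-sublist (there u∈a) (here refl) _ = inj₂ (refl ∷ from∈ u∈a)
∈-pair-sublist {a = x ∷ _} (there u∈a) (there w∈a) u≢w =
  Sum.map (x Sublist.∷ʳ_) (x Sublist.∷ʳ_) (∈-pair-sublist u∈a w∈a u≢w)

-- The split L n R in the definition of s: n is a largest entry, taken at its first occurrence
-- because that is where splitAt cuts.
record MaxSplit (xs : List ℕ) : Set where
  constructor maxSplit
  field
    left   : List ℕ
    top    : ℕ
    right  : List ℕ
    split  : xs ≡ left ++ top ∷ right
    left<  : All (_< top) left
    right≤ : All (_≤ top) right

maxSplit-∷ : ∀ x xs → MaxSplit (x ∷ xs)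
maxSplit-∷ x [] = maxSplit [] x [] refl [] []
maxSplit-∷ x (y ∷ ys) with maxSplit-∷ y ys
... | maxSplit L M R y∷ys≡ L<M R≤M with x <? M
...   | yes x<M = maxSplit (x ∷ L) M R (cong (x ∷_) y∷ys≡) (x<M ∷ L<M) R≤M
...   | no x≮M = maxSplit [] x (y ∷ ys) refl [] (subst (All (_≤ x)) (sym y∷ys≡)
                   (All.map (λ y≤M → ≤-trans y≤M (≮⇒≥ x≮M))
                            (All.++⁺ (All.map <⇒≤ L<M) (≤-refl ∷ R≤M))))

module _ (P : List ℕ → Set) (P[] : P [])
         (P-split : ∀ {L M R} → All (_< M) L → All (_≤ M) R →
                    P L → P R → P (L ++ M ∷ R)) where

  max-induction : ∀ xs → P xs
  max-induction xs = go (length xs) xs ≤-refl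
    where
    go : ∀ n xs → length xs ≤ n → P xs
    go n [] _ = P[]
    go (suc n) (x ∷ xs) ≤1+n with maxSplit-∷ x xs
    ... | maxSplit L M R x∷xs≡ L<M R≤M =
      let |L|≤n , |R|≤n = split-shorter L M R (subst (λ ys → length ys ≤ suc n) x∷xs≡ ≤1+n)
      in subst P (sym x∷xs≡) (P-split L<M R≤M (go n L |L|≤n) (go n R |R|≤n))

maxL-split : ∀ L M R → All (_< M) L → All (_≤ M) R → maxL (L ++ M ∷ R) ≡ M
maxL-split L M R L<M R≤M = ≤-antisym (maxL-least (All.++⁺ (All.map <⇒≤ L<M) (≤-refl ∷ R≤M)))
                                     (maxL-greatest L)
  where
  maxL-least : ∀ {xs} → All (_≤ M) xs → maxL xs ≤ M
  maxL-least [] = z≤n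
  maxL-least (x≤M ∷ xs≤M) = ⊔-lub x≤M (maxL-least xs≤M)
  maxL-greatest : ∀ L → M ≤ maxL (L ++ M ∷ R)
  maxL-greatest [] = m≤m⊔n M (maxL R)
  maxL-greatest (x ∷ L) = ≤-trans (maxL-greatest L) (m≤n⊔m x _)

splitAt-first : ∀ {M} L R → All (_≢ M) L → splitAt M (L ++ M ∷ R) ≡ (L , R)
splitAt-first {M} [] R [] with M ≟ M
... | yes _ = refl
... | no M≢M = ⊥-elim (M≢M refl)
splitAt-first {M} (x ∷ L) R (x≢M ∷ L≢M) with x ≟ M
... | yes x≡M = ⊥-elim (x≢M x≡M)
... | no _ rewrite splitAt-first L R L≢M = refl

sFuel-unfold : ∀ f xs → xs ≢ [] → sFuel (suc f) xs ≡
  sFuel f (proj₁ (splitAt (maxL xs) xs)) ++ sFuel f (proj₂ (splitAt (maxL xs) xs)) ++ [ maxL xs ]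
sFuel-unfold f [] xs≢[] = ⊥-elim (xs≢[] refl)
sFuel-unfold f (x ∷ xs) _ with splitAt (maxL (x ∷ xs)) (x ∷ xs)
... | _ = refl

split≢[] : ∀ (L : List ℕ) M R → L ++ M ∷ R ≢ []
split≢[] [] _ _ ()
split≢[] (_ ∷ _) _ _ ()

sFuel-suc : ∀ f L M R → All (_< M) L → All (_≤ M) R →
  sFuel (suc f) (L ++ M ∷ R) ≡ sFuel f L ++ sFuel f R ++ [ M ]
sFuel-suc f L M R L<M R≤M
  rewrite sFuel-unfold f (L ++ M ∷ R) (split≢[] L M R)
        | maxL-split L M R L<M R≤M
        | splitAt-first L R (All.map (λ x<M x≡M → <-irrefl x≡M x<M) L<M) = refl

sFuel-[] : ∀ f → sFuel f [] ≡ []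
sFuel-[] zero = refl
sFuel-[] (suc f) = refl

FuelIndependent : List ℕ → Set
FuelIndependent xs = ∀ f g → length xs ≤ f → length xs ≤ g → sFuel f xs ≡ sFuel g xs

sFuel-enough : ∀ xs → FuelIndependent xs
sFuel-enough = max-induction FuelIndependent (λ f g _ _ → trans (sFuel-[] f) (sym (sFuel-[] g))) step
  where
  step : ∀ {L M R} → All (_< M) L → All (_≤ M) R →
         FuelIndependent L → FuelIndependent R → FuelIndependent (L ++ M ∷ R)
  step {L} {M} {R} L<M R≤M IH-L IH-R (suc f) (suc g) ≤f ≤g =
    let |L|≤f , |R|≤f = split-shorter L M R ≤f
        |L|≤g , |R|≤g = split-shorter L M R ≤g
    in trans (sFuel-suc f L M R L<M R≤M)
             (trans (cong₂ (λ sL sR → sL ++ sR ++ [ M ])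
                           (IH-L f g |L|≤f |L|≤g) (IH-R f g |R|≤f |R|≤g))
                    (sym (sFuel-suc g L M R L<M R≤M)))
  step {L} {M} {R} _ _ _ _ zero _ ≤0 _ = ⊥-elim (n≮0 (subst (_≤ 0) (length-split L M R) ≤0))
  step {L} {M} {R} _ _ _ _ _ zero _ ≤0 = ⊥-elim (n≮0 (subst (_≤ 0) (length-split L M R) ≤0))

stackSort-split : ∀ L M R → All (_< M) L → All (_≤ M) R →
  stackSort (L ++ M ∷ R) ≡ stackSort L ++ stackSort R ++ [ M ]
stackSort-split L M R L<M R≤M = begin
  sFuel (length (L ++ M ∷ R)) (L ++ M ∷ R)  ≡⟨ cong (λ f → sFuel f (L ++ M ∷ R)) |L++M∷R|≡ ⟩
  sFuel (suc n) (L ++ M ∷ R)                 ≡⟨ sFuel-suc n L M R L<M R≤M ⟩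
  sFuel n L ++ sFuel n R ++ [ M ]            ≡⟨ cong₂ (λ sL sR → sL ++ sR ++ [ M ])
                                                   (sFuel-enough L n _ (m≤m+n _ _) ≤-refl)
                                                   (sFuel-enough R n _ (m≤n+m _ _) ≤-refl) ⟩
  stackSort L ++ stackSort R ++ [ M ]        ∎
  where
  open ≡-Reasoning
  n = length L + length R
  |L++M∷R|≡ = length-split L M R

stackSort-↭ : ∀ xs → stackSort xs ↭ xs
stackSort-↭ = max-induction (λ xs → stackSort xs ↭ xs) ↭-refl step
  where
  step : ∀ {L M R} → All (_< M) L → All (_≤ M) R →
         stackSort L ↭ L → stackSort R ↭ R → stackSort (L ++ M ∷ R) ↭ L ++ M ∷ R
  step {L} {M} {R} L<M R≤M sL↭L sR↭R =
    ↭-trans (↭-reflexive (stackSort-split L M R L<M R≤M))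
            (↭.++⁺ sL↭L (↭-trans (↭.++⁺ʳ [ M ] sR↭R) (↭.++-comm R [ M ])))

stackSort-All : ∀ {P : ℕ → Set} xs → All P xs → All P (stackSort xs)
stackSort-All xs = ↭.All-resp-↭ (↭-sym (stackSort-↭ xs))

stackSort-All⁻ : ∀ {P : ℕ → Set} xs → All P (stackSort xs) → All P xs
stackSort-All⁻ xs = ↭.All-resp-↭ (stackSort-↭ xs)

stackSort-≡[] : ∀ τ → stackSort τ ≡ [] → τ ≡ []
stackSort-≡[] τ sτ≡[] = ↭.↭-empty-inv (↭-sym (subst (_↭ τ) sτ≡[] (stackSort-↭ τ)))

preimage-IsPerm : ∀ {n π} σ → stackSort σ ≡ π → IsPerm n π → IsPerm n σ
preimage-IsPerm σ refl (|π|≡n , π-unique , π-range) =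
  trans (sym (↭.↭-length σ↭π)) |π|≡n ,
  Unique-resp-↭ (↭⇒↭ₛ σ↭π) π-unique ,
  λ x x∈σ → π-range x (↭.∈-resp-↭ (↭-sym σ↭π) x∈σ)
  where σ↭π = stackSort-↭ σ

preimage-split : ∀ τ y M → stackSort τ ≡ y ∷ʳ M →
  ∃₂ λ L R → τ ≡ L ++ M ∷ R × stackSort L ++ stackSort R ≡ y
preimage-split [] y M []≡ = ⊥-elim ([]≢∷ʳ y M []≡)
preimage-split (x ∷ xs) y M sτ≡ with maxSplit-∷ x xs
... | maxSplit L M′ R τ≡ L<M′ R≤M′ =
  let sL++sR≡y , M′≡M = ∷ʳ-injective (stackSort L ++ stackSort R) y (begin
        (stackSort L ++ stackSort R) ∷ʳ M′    ≡⟨ ++-assoc (stackSort L) (stackSort R) [ M′ ] ⟩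
        stackSort L ++ stackSort R ++ [ M′ ]  ≡⟨ stackSort-split L M′ R L<M′ R≤M′ ⟨
        stackSort (L ++ M′ ∷ R)               ≡⟨ cong stackSort τ≡ ⟨
        stackSort (x ∷ xs)                    ≡⟨ sτ≡ ⟩
        y ∷ʳ M                                ∎)
  in L , R , trans τ≡ (cong (λ m → L ++ m ∷ R) M′≡M) , sL++sR≡y
  where open ≡-Reasoning

preimage-join : ∀ σ₁ σ₂ {y₁ y₂ M} → stackSort σ₁ ≡ y₁ → stackSort σ₂ ≡ y₂ →
  All (_< M) y₁ → All (_≤ M) y₂ → stackSort (σ₁ ++ M ∷ σ₂) ≡ y₁ ++ y₂ ++ [ M ]
preimage-join σ₁ σ₂ {M = M} refl refl y₁<M y₂≤M =
  stackSort-split σ₁ M σ₂ (stackSort-All⁻ σ₁ y₁<M) (stackSort-All⁻ σ₂ y₂≤M)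

-- Heights are natural numbers, so a path never goes below the axis.
data Path : ℕ → ℕ → List Step → Set where
  []   : ∀ {h} → Path h h []
  up   : ∀ {h e p} → Path (suc h) e p → Path h e (U ∷ p)
  down : ∀ {h e p} → Path h e p → Path (suc h) e (D ∷ p)

Path-++ : ∀ {h m e p q} → Path h m p → Path m e q → Path h e (p ++ q)
Path-++ [] w = w
Path-++ (up v) w = up (Path-++ v w)
Path-++ (down v) w = down (Path-++ v w)

Path-split : ∀ {h e} p {q} → Path h e (p ++ q) → ∃ λ m → Path h m p × Path m e q
Path-split [] v = _ , [] , v
Path-split (U ∷ p) (up v) = let m , v₁ , v₂ = Path-split p v in m , up v₁ , v₂
Path-split (D ∷ p) (down v) = let m , v₁ , v₂ = Path-split p v in m , down v₁ , v₂

Path-raise : ∀ t {h e p} → Path h e p → Path (h + t) (e + t) p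
Path-raise t [] = []
Path-raise t (up v) = up (Path-raise t v)
Path-raise t (down v) = down (Path-raise t v)

Path-heights : ∀ {h e h′ e′ p} → Path h e p → Path h′ e′ p → h + e′ ≡ h′ + e
Path-heights {h} {h′ = h′} [] [] = +-comm h h′
Path-heights (up v) (up w) = suc-injective (Path-heights v w)
Path-heights (down v) (down w) = cong suc (Path-heights v w)

Path-irrelevant : ∀ {h e p} (v w : Path h e p) → v ≡ w
Path-irrelevant [] [] = refl
Path-irrelevant (up v) (up w) = cong up (Path-irrelevant v w)
Path-irrelevant (down v) (down w) = cong down (Path-irrelevant v w)

valid⇒Path : ∀ h p → ValidFrom h p → Path h 0 p
valid⇒Path h [] refl = []
valid⇒Path h (U ∷ p) v = up (valid⇒Path (suc h) p v)
valid⇒Path (suc h) (D ∷ p) v = down (valid⇒Path h p v)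

Path⇒valid : ∀ {h p} → Path h 0 p → ValidFrom h p
Path⇒valid [] = refl
Path⇒valid (up v) = Path⇒valid v
Path⇒valid (down v) = Path⇒valid v

ups : List Step → ℕ
ups [] = 0
ups (U ∷ p) = suc (ups p)
ups (D ∷ p) = ups p

downs : List Step → ℕ
downs [] = 0
downs (U ∷ p) = downs p
downs (D ∷ p) = suc (downs p)

ups+downs : ∀ p → ups p + downs p ≡ length p
ups+downs [] = refl
ups+downs (U ∷ p) = cong suc (ups+downs p)
ups+downs (D ∷ p) = trans (+-suc (ups p) (downs p)) (cong suc (ups+downs p))

Path-ups-downs : ∀ {h e p} → Path h e p → h + ups p ≡ e + downs p
Path-ups-downs [] = refl
Path-ups-downs {h} (up {p = p} v) = trans (+-suc h (ups p)) (Path-ups-downs v)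
Path-ups-downs {e = e} (down {p = p} v) = trans (cong suc (Path-ups-downs v)) (sym (+-suc e (downs p)))

Path-no-ups : ∀ {h p} → Path h 0 p → ups p ≡ 0 → p ≡ replicate h D
Path-no-ups [] _ = refl
Path-no-ups (down v) ups≡0 = cong (D ∷_) (Path-no-ups v ups≡0)

Path-no-return : ∀ {m m′ r} → Path (suc m) 0 r → Path 0 m′ r → ⊥
Path-no-return v w with Path-heights v w
... | ()

Path-before-Dyck : ∀ {h} q {p} → Path h 0 (q ++ U ∷ p) → Path 0 0 p → ⊥
Path-before-Dyck q v dyck with Path-split q v
... | _ , _ , up w = Path-no-return w dyck

Path-ends-down : ∀ {h} p s → Path h 0 (p ++ s ∷ []) → s ≡ D × Path h 1 p
Path-ends-down p s v with Path-split p v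
... | _ , v₁ , down [] = refl , v₁

Path-last-return : ∀ {h p} → Path h 1 p →
  (∃ λ h′ → h ≡ suc h′ × Path h′ 0 p) ⊎
  (∃₂ λ p₁ p₂ → p ≡ p₁ ++ U ∷ p₂ × Path h 0 p₁ × Path 0 0 p₂)
Path-last-return [] = inj₁ (0 , refl , [])
Path-last-return {zero} (up v) with Path-last-return v
... | inj₁ (_ , refl , w) = inj₂ ([] , _ , refl , [] , w)
... | inj₂ (p₁ , p₂ , refl , v₁ , v₂) = inj₂ (U ∷ p₁ , p₂ , refl , up v₁ , v₂)
Path-last-return {suc h} (up v) with Path-last-return v
... | inj₁ (_ , refl , w) = inj₁ (h , refl , up w)
... | inj₂ (p₁ , p₂ , refl , v₁ , v₂) = inj₂ (U ∷ p₁ , p₂ , refl , up v₁ , v₂)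
Path-last-return (down v) with Path-last-return v
... | inj₁ (h′ , refl , w) = inj₁ (suc h′ , refl , down w)
... | inj₂ (p₁ , p₂ , refl , v₁ , v₂) = inj₂ (D ∷ p₁ , p₂ , refl , down v₁ , v₂)

junction-unique : ∀ {hA hB j q₁ q₂ p₁ p₂} → Path hA 0 q₁ → Path hB 0 q₂ → Path 0 0 p₂ →
  q₁ ++ j ∷ q₂ ≡ p₁ ++ U ∷ p₂ → q₁ ≡ p₁
junction-unique {q₁ = q₁} {q₂} {p₁} {p₂} v₁ v₂ dyck eq with ++-≡-++ q₁ _ p₁ _ eq
... | inj₁ ([] , p₁≡ , _) = sym (trans p₁≡ (++-identityʳ q₁))
... | inj₁ (_ ∷ r , _ , j∷q₂≡) with ∷-injective j∷q₂≡
...   | _ , refl = ⊥-elim (Path-before-Dyck r v₂ dyck)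
junction-unique {q₁ = q₁} v₁ v₂ dyck eq | inj₂ ([] , q₁≡ , _) = trans q₁≡ (++-identityʳ _)
junction-unique {p₁ = p₁} v₁ v₂ dyck eq | inj₂ (s ∷ r , refl , U∷p₂≡)
  with ∷-injective U∷p₂≡
... | refl , refl with Path-split p₁ v₁ | Path-split r dyck
...   | _ , _ , up w | _ , w′ , _ = ⊥-elim (Path-no-return w w′)

stepOf : ℕ → ℕ → Step
stepOf a b with b <? a
... | yes _ = U
... | no _ = D

stepOf-U : ∀ {a b} → b < a → stepOf a b ≡ U
stepOf-U {a} {b} b<a with b <? a
... | yes _ = refl
... | no b≮a = ⊥-elim (b≮a b<a)

stepOf-D : ∀ {a b} → a ≤ b → stepOf a b ≡ D
stepOf-D {a} {b} a≤b with b <? a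
... | yes b<a = ⊥-elim (<⇒≱ b<a a≤b)
... | no _ = refl

wordFrom : ℕ → List ℕ → List Step
wordFrom a [] = []
wordFrom a (b ∷ bs) = stepOf a b ∷ wordFrom b bs

word : List ℕ → List Step
word [] = []
word (a ∷ as) = wordFrom a as

lastFrom : ℕ → List ℕ → ℕ
lastFrom a [] = a
lastFrom a (b ∷ bs) = lastFrom b bs

lastFrom-∈ : ∀ a as → lastFrom a as ∈ a ∷ as
lastFrom-∈ a [] = here refl
lastFrom-∈ a (b ∷ bs) = there (lastFrom-∈ b bs)

length-wordFrom : ∀ a as → length (wordFrom a as) ≡ length as
length-wordFrom a [] = refl
length-wordFrom a (b ∷ bs) = cong suc (length-wordFrom b bs)

length-word : ∀ π → length (word π) ≡ pred (length π)
length-word [] = refl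
length-word (a ∷ as) = length-wordFrom a as

wordFrom-++ : ∀ a as b bs →
  wordFrom a (as ++ b ∷ bs) ≡ wordFrom a as ++ stepOf (lastFrom a as) b ∷ wordFrom b bs
wordFrom-++ a [] b bs = refl
wordFrom-++ a (c ∷ cs) b bs = cong (stepOf a c ∷_) (wordFrom-++ c cs b bs)

wordFrom-split : ∀ a as p₁ s p₂ → wordFrom a as ≡ p₁ ++ s ∷ p₂ →
  ∃₂ λ as₁ b → ∃ λ bs → as ≡ as₁ ++ b ∷ bs ×
    wordFrom a as₁ ≡ p₁ × stepOf (lastFrom a as₁) b ≡ s × wordFrom b bs ≡ p₂
wordFrom-split a [] [] s p₂ ()
wordFrom-split a [] (_ ∷ _) s p₂ ()
wordFrom-split a (b ∷ bs) [] s p₂ refl = [] , b , bs , refl , refl , refl , refl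
wordFrom-split a (b ∷ bs) (s′ ∷ p₁) s p₂ eq with ∷-injective eq
... | refl , eq′ with wordFrom-split b bs p₁ s p₂ eq′
...   | as₁ , c , cs , refl , refl , s≡ , refl = b ∷ as₁ , c , cs , refl , refl , s≡ , refl

wordFrom-∷ʳ-max : ∀ {h} a as M → All (_≤ M) (a ∷ as) → Path h 0 (wordFrom a as) →
  Path (suc h) 0 (wordFrom a (as ∷ʳ M))
wordFrom-∷ʳ-max {h} a as M as≤M v
  rewrite wordFrom-++ a as M [] | stepOf-D (All.lookup as≤M (lastFrom-∈ a as)) | sym (+-comm h 1) =
  Path-++ (Path-raise 1 v) (down [])

wordFrom-join : ∀ {h h′} a as b bs → Path h 0 (wordFrom a as) → Path (suc h′) 0 (wordFrom b bs) →
  ∃ λ t → Path t 0 (wordFrom a (as ++ b ∷ bs))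
wordFrom-join a as b bs v w
  rewrite wordFrom-++ a as b bs with stepOf (lastFrom a as) b
... | U = _ , Path-++ (Path-raise _ v) (up w)
... | D = _ , Path-++ (Path-raise _ v) (down w)

word-max-∷ʳ : ∀ {a b} A B M → All (_< M) A → All (_≤ M) B →
  Path a 0 (word A) → Path b 0 (word B) → ∃ λ h → Path h 0 (word (A ++ B ++ [ M ]))
word-max-∷ʳ [] [] M _ _ _ _ = 0 , []
word-max-∷ʳ [] (b ∷ bs) M _ B≤M _ w = _ , wordFrom-∷ʳ-max b bs M B≤M w
word-max-∷ʳ (a ∷ as) [] M A<M _ v _ = _ , wordFrom-∷ʳ-max a as M (All.map <⇒≤ A<M) v
word-max-∷ʳ (a ∷ as) (b ∷ bs) M _ B≤M v w =
  wordFrom-join a as b (bs ∷ʳ M) v (wordFrom-∷ʳ-max b bs M B≤M w)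

sorted-Path : ∀ τ → ∃ λ h → Path h 0 (word (stackSort τ))
sorted-Path = max-induction (λ τ → ∃ λ h → Path h 0 (word (stackSort τ))) (0 , []) step
  where
  step : ∀ {L M R} → All (_< M) L → All (_≤ M) R →
         ∃ (λ h → Path h 0 (word (stackSort L))) → ∃ (λ h → Path h 0 (word (stackSort R))) →
         ∃ λ h → Path h 0 (word (stackSort (L ++ M ∷ R)))
  step {L} {M} {R} L<M R≤M (_ , vL) (_ , vR)
    rewrite stackSort-split L M R L<M R≤M =
    word-max-∷ʳ (stackSort L) (stackSort R) M (stackSort-All L L<M) (stackSort-All R R≤M) vL vR

-- Sequences whose entries are all left-to-right maxima or minima

ExtremalAfter : List ℕ → List ℕ → Set
ExtremalAfter a [] = ⊤
ExtremalAfter a (e ∷ b) = (All (_< e) a ⊎ All (e <_) a) × ExtremalAfter (a ∷ʳ e) b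

Extremal : List ℕ → Set
Extremal = ExtremalAfter []

ExtremalAfter-++ : ∀ a b {c} → ExtremalAfter a (b ++ c) → ExtremalAfter a b × ExtremalAfter (a ++ b) c
ExtremalAfter-++ a [] {c} ext = tt , subst (λ a′ → ExtremalAfter a′ c) (sym (++-identityʳ a)) ext
ExtremalAfter-++ a (e ∷ b) {c} (e-ext , ext) =
  let ext-b , ext-c = ExtremalAfter-++ (a ∷ʳ e) b ext
  in (e-ext , ext-b) , subst (λ a′ → ExtremalAfter a′ c) (++-assoc a [ e ] b) ext-c

ExtremalAfter-drop : ∀ a b c → ExtremalAfter (a ++ b) c → ExtremalAfter b c
ExtremalAfter-drop a b [] _ = tt
ExtremalAfter-drop a b (e ∷ c) (e-ext , ext) =
  Sum.map (All.++⁻ʳ a) (All.++⁻ʳ a) e-ext ,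
  ExtremalAfter-drop a (b ∷ʳ e) c (subst (λ a′ → ExtremalAfter a′ c) (++-assoc a b [ e ]) ext)

Extremal-++ : ∀ b {c} → Extremal (b ++ c) → Extremal b × Extremal c
Extremal-++ b {c} ext =
  let ext-b , ext-c = ExtremalAfter-++ [] b ext
  in ext-b , ExtremalAfter-drop b [] c (subst (λ a → ExtremalAfter a c) (sym (++-identityʳ b)) ext-c)

Extremal-init : ∀ {y M} → Extremal (y ∷ʳ M) → Extremal y
Extremal-init {y} ext = proj₁ (Extremal-++ y ext)

Extremal-last : ∀ y M → Extremal (y ∷ʳ M) → All (_< M) y ⊎ All (M <_) y
Extremal-last y M ext = proj₁ (proj₂ (ExtremalAfter-++ [] y ext))

last-entry : ∀ c cs M → Extremal (c ∷ cs ∷ʳ M) →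
  (All (_< M) (c ∷ cs) × stepOf (lastFrom c cs) M ≡ D) ⊎
  (All (M <_) (c ∷ cs) × stepOf (lastFrom c cs) M ≡ U)
last-entry c cs M ext =
  Sum.map (λ y<M → y<M , stepOf-D (<⇒≤ (All.lookup y<M (lastFrom-∈ c cs))))
          (λ M<y → M<y , stepOf-U (All.lookup M<y (lastFrom-∈ c cs)))
          (Extremal-last (c ∷ cs) M ext)

ExtremalAfter-distinct : ∀ {x a} b → x ∈ a → ExtremalAfter a b → All (x ≢_) b
ExtremalAfter-distinct [] _ _ = []
ExtremalAfter-distinct (e ∷ b) x∈a (e-ext , ext) =
  Sum.[ (λ a<e → <⇒≢ (All.lookup a<e x∈a)) , (λ e<a → >⇒≢ (All.lookup e<a x∈a)) ] e-ext ∷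
  ExtremalAfter-distinct b (∈-++⁺ˡ x∈a) ext

ExtremalAfter-Unique : ∀ a b → ExtremalAfter a b → Unique b
ExtremalAfter-Unique a [] _ = AllPairs.[]
ExtremalAfter-Unique a (e ∷ b) (_ , ext) =
  ExtremalAfter-distinct b (∈-++⁺ʳ a (here refl)) ext AllPairs.∷ ExtremalAfter-Unique (a ∷ʳ e) b ext

1<2 : 1 < 2
1<2 = ≤-refl

1<3 : 1 < 3
1<3 = s≤s (s≤s z≤n)

3≮1 : ¬ 3 < 1
3≮1 (s≤s ())

3≮2 : ¬ 3 < 2
3≮2 (s≤s (s≤s ()))

Extremal-sublist : ∀ {x u w c} → Extremal x → (u ∷ w ∷ c ∷ []) Sublist.⊆ x →
  All (_< c) (u ∷ w ∷ []) ⊎ All (c <_) (u ∷ w ∷ [])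
Extremal-sublist {u = u} {w} ext uwc⊆x with sublist-∷ʳ (u ∷ w ∷ []) uwc⊆x
... | pre , post , refl , uw⊆pre =
  Sum.map (All-resp-⊆ uw⊆pre) (All-resp-⊆ uw⊆pre) (proj₁ (proj₂ (ExtremalAfter-++ [] pre ext)))

Extremal⇒Avoids-132 : ∀ {x} → Extremal x → Avoids x (1 ∷ 3 ∷ 2 ∷ [])
Extremal⇒Avoids-132 ext (a ∷ b ∷ c ∷ [] , abc⊆x , (_ ∷ a<c⇔1<2 ∷ []) , (b<c⇔3<2 ∷ []) , _)
  with Extremal-sublist ext abc⊆x
... | inj₁ (_ ∷ b<c ∷ []) = 3≮2 (Equivalence.to b<c⇔3<2 b<c)
... | inj₂ (c<a ∷ _) = <-asym c<a (Equivalence.from a<c⇔1<2 1<2)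
Extremal⇒Avoids-132 _ ([] , _ , ())
Extremal⇒Avoids-132 _ (_ ∷ [] , _ , () , _)
Extremal⇒Avoids-132 _ (_ ∷ _ ∷ [] , _ , (_ ∷ ()) , _)
Extremal⇒Avoids-132 _ (_ ∷ _ ∷ _ ∷ _ ∷ _ , _ , (_ ∷ _ ∷ ()) , _)

Extremal⇒Avoids-312 : ∀ {x} → Extremal x → Avoids x (3 ∷ 1 ∷ 2 ∷ [])
Extremal⇒Avoids-312 ext (a ∷ b ∷ c ∷ [] , abc⊆x , (_ ∷ a<c⇔3<2 ∷ []) , (b<c⇔1<2 ∷ []) , _)
  with Extremal-sublist ext abc⊆x
... | inj₁ (a<c ∷ _) = 3≮2 (Equivalence.to a<c⇔3<2 a<c)
... | inj₂ (_ ∷ c<b ∷ []) = <-asym c<b (Equivalence.from b<c⇔1<2 1<2)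
Extremal⇒Avoids-312 _ ([] , _ , ())
Extremal⇒Avoids-312 _ (_ ∷ [] , _ , () , _)
Extremal⇒Avoids-312 _ (_ ∷ _ ∷ [] , _ , (_ ∷ ()) , _)
Extremal⇒Avoids-312 _ (_ ∷ _ ∷ _ ∷ _ ∷ _ , _ , (_ ∷ _ ∷ ()) , _)

⇔-both : ∀ {A B : Set} → A → B → A ⇔ B
⇔-both a b = mk⇔ (λ _ → b) (λ _ → a)

⇔-neither : ∀ {A B : Set} → ¬ A → ¬ B → A ⇔ B
⇔-neither ¬a ¬b = mk⇔ (λ a → ⊥-elim (¬a a)) (λ b → ⊥-elim (¬b b))

pattern-312 : ∀ {u w e} → w < e → e < u → SameOrder (u ∷ w ∷ e ∷ []) (3 ∷ 1 ∷ 2 ∷ [])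
pattern-312 w<e e<u =
  (⇔-neither (<-asym (<-trans w<e e<u)) 3≮1 ∷ ⇔-neither (<-asym e<u) 3≮2 ∷ []) ,
  (⇔-both w<e 1<2 ∷ []) , [] , tt

pattern-132 : ∀ {u w e} → w < e → e < u → SameOrder (w ∷ u ∷ e ∷ []) (1 ∷ 3 ∷ 2 ∷ [])
pattern-132 w<e e<u =
  (⇔-both (<-trans w<e e<u) 1<3 ∷ ⇔-both w<e 1<2 ∷ []) ,
  (⇔-neither (<-asym e<u) 3≮2 ∷ []) , [] , tt

-- The entry e of a ++ e ∷ b either exceeds or undercuts all of a, else two entries of a
-- on either side of e form a 132 or a 312 with it.
entry-extremal : ∀ a e b → Unique (a ++ e ∷ b) →
  Avoids (a ++ e ∷ b) (1 ∷ 3 ∷ 2 ∷ []) → Avoids (a ++ e ∷ b) (3 ∷ 1 ∷ 2 ∷ []) →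
  All (_< e) a ⊎ All (e <_) a
entry-extremal a e b unique av-132 av-312 with All.all? (_<? e) a | All.all? (e <?_) a
... | yes a<e | _ = inj₁ a<e
... | no _ | yes e<a = inj₂ e<a
... | no ¬a<e | no ¬e<a =
  let u , u∈a , u≮e = find (All.¬All⇒Any¬ (_<? e) a ¬a<e)
      w , w∈a , e≮w = find (All.¬All⇒Any¬ (e <?_) a ¬e<a)
      e∉a = Unique-∉ a unique
      e<u = ≤∧≢⇒< (≮⇒≥ u≮e) (λ e≡u → e∉a (subst (_∈ a) (sym e≡u) u∈a))
      w<e = ≤∧≢⇒< (≮⇒≥ e≮w) (λ w≡e → e∉a (subst (_∈ a) w≡e w∈a))
      with-e : ∀ {ys} → ys Sublist.⊆ a → ys ∷ʳ e Sublist.⊆ a ++ e ∷ b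
      with-e ys⊆a = ⊆-++⁺ ys⊆a (refl ∷ minimum b)
  in ⊥-elim (Sum.[ (λ uw⊆a → av-312 (_ , with-e uw⊆a , pattern-312 w<e e<u))
                 , (λ wu⊆a → av-132 (_ , with-e wu⊆a , pattern-132 w<e e<u)) ]
               (∈-pair-sublist u∈a w∈a (>⇒≢ (<-trans w<e e<u))))

Avoids⇒ExtremalAfter : ∀ a b → Unique (a ++ b) →
  Avoids (a ++ b) (1 ∷ 3 ∷ 2 ∷ []) → Avoids (a ++ b) (3 ∷ 1 ∷ 2 ∷ []) → ExtremalAfter a b
Avoids⇒ExtremalAfter a [] _ _ _ = tt
Avoids⇒ExtremalAfter a (e ∷ b) unique av-132 av-312 =
  entry-extremal a e b unique av-132 av-312 ,
  Avoids⇒ExtremalAfter (a ∷ʳ e) b (subst Unique a++e∷b≡ unique)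
    (subst (λ x → Avoids x _) a++e∷b≡ av-132) (subst (λ x → Avoids x _) a++e∷b≡ av-312)
  where a++e∷b≡ = sym (++-assoc a [ e ] b)

Avoids⇒Extremal : ∀ {x} → Unique x →
  Avoids x (1 ∷ 3 ∷ 2 ∷ []) → Avoids x (3 ∷ 1 ∷ 2 ∷ []) → Extremal x
Avoids⇒Extremal = Avoids⇒ExtremalAfter [] _

UniquePreimage : List ℕ → Set
UniquePreimage x = ∃ λ σ → stackSort σ ≡ x × ∀ τ → stackSort τ ≡ x → τ ≡ σ

TwoPreimages : List ℕ → Set
TwoPreimages x = ∃₂ λ σ σ′ → stackSort σ ≡ x × stackSort σ′ ≡ x × σ ≢ σ′

-- Indexed by the starting height of the path of x.
Preimages : ℕ → List ℕ → Set
Preimages zero = UniquePreimage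
Preimages (suc _) = TwoPreimages

Preimages-sorted : ∀ h {x} → Preimages h x → ∃ λ σ → stackSort σ ≡ x
Preimages-sorted zero (σ , sσ≡ , _) = σ , sσ≡
Preimages-sorted (suc _) (σ , _ , sσ≡ , _) = σ , sσ≡

UniquePreimage-[] : UniquePreimage []
UniquePreimage-[] = [] , refl , stackSort-≡[]

UniquePreimage-[_] : ∀ M → UniquePreimage [ M ]
UniquePreimage-[ M ] = [ M ] , stackSort-split [] M [] [] [] , unique
  where
  unique : ∀ τ → stackSort τ ≡ [ M ] → τ ≡ [ M ]
  unique τ sτ≡ with preimage-split τ [] M sτ≡
  ... | L , R , refl , sL++sR≡[] =
    cong₂ (λ L R → L ++ M ∷ R) (stackSort-≡[] L (++-conicalˡ _ _ sL++sR≡[]))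
                               (stackSort-≡[] R (++-conicalʳ _ _ sL++sR≡[]))

-- σ ++ [M] and M ∷ σ sort to the same sequence.
TwoPreimages-∷ʳ : ∀ {M} c cs → All (_< M) (c ∷ cs) → (∃ λ ρ → stackSort ρ ≡ c ∷ cs) →
  TwoPreimages (c ∷ cs ∷ʳ M)
TwoPreimages-∷ʳ {M} c cs y<M (ρ , sρ≡) =
  ρ ∷ʳ M , M ∷ ρ ,
  preimage-join ρ [] sρ≡ refl y<M [] ,
  preimage-join [] ρ refl sρ≡ [] (All.map <⇒≤ y<M) ,
  distinct ρ sρ≡
  where
  distinct : ∀ ρ → stackSort ρ ≡ c ∷ cs → ρ ∷ʳ M ≢ M ∷ ρ
  distinct [] ()
  distinct (r ∷ rs) sρ≡ eq with ∷-injective eq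
  ... | refl , _ =
    <-irrefl refl (All.lookup (stackSort-All⁻ (r ∷ rs) (subst (All (_< M)) (sym sρ≡) y<M)) (here refl))

sorted-cut-unique : ∀ {hA hB} A B e es y₂ → Path hA 0 (word A) → Path hB 0 (word B) →
  word (e ∷ es ++ y₂) ≡ wordFrom e es ++ U ∷ word y₂ → Path 0 0 (word y₂) →
  A ++ B ≡ (e ∷ es) ++ y₂ → A ≡ e ∷ es
sorted-cut-unique [] B e es y₂ _ vB word≡ dyck refl =
  ⊥-elim (Path-before-Dyck (wordFrom e es) (subst (Path _ 0) word≡ vB) dyck)
sorted-cut-unique (a ∷ as) [] e es y₂ vA _ word≡ dyck eq =
  ⊥-elim (Path-before-Dyck (wordFrom e es)
           (subst (Path _ 0) (trans (cong word (trans (sym (++-identityʳ (a ∷ as))) eq)) word≡) vA) dyck)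
sorted-cut-unique (a ∷ as) (b ∷ bs) e es y₂ vA vB word≡ dyck eq =
  ++-cancel-length (a ∷ as) (e ∷ es) (cong suc |as|≡|es|) eq
  where
  open ≡-Reasoning
  words≡ : wordFrom a as ++ stepOf (lastFrom a as) b ∷ wordFrom b bs ≡ wordFrom e es ++ U ∷ word y₂
  words≡ = begin
    wordFrom a as ++ stepOf (lastFrom a as) b ∷ wordFrom b bs  ≡⟨ wordFrom-++ a as b bs ⟨
    word ((a ∷ as) ++ b ∷ bs)                                  ≡⟨ cong word eq ⟩
    word ((e ∷ es) ++ y₂)                                      ≡⟨ word≡ ⟩
    wordFrom e es ++ U ∷ word y₂                               ∎
  |as|≡|es| : length as ≡ length es
  |as|≡|es| = begin
    length as               ≡⟨ length-wordFrom a as ⟨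
    length (wordFrom a as)  ≡⟨ cong length (junction-unique vA vB dyck words≡) ⟩
    length (wordFrom e es)  ≡⟨ length-wordFrom e es ⟩
    length es               ∎

Preimages-at-return : ∀ h {M} e es y₂ → All (_< M) (e ∷ es ++ y₂) →
  word (e ∷ es ++ y₂) ≡ wordFrom e es ++ U ∷ word y₂ → Path 0 0 (word y₂) →
  Preimages h (e ∷ es) → UniquePreimage y₂ → Preimages h ((e ∷ es ++ y₂) ∷ʳ M)
Preimages-at-return h {M} e es y₂ y<M word≡ dyck pre₁ (σ₂ , sσ₂≡ , uniq₂) = go h pre₁
  where
  y₁ = e ∷ es
  sorts : ∀ σ → stackSort σ ≡ y₁ → stackSort (σ ++ M ∷ σ₂) ≡ (y₁ ++ y₂) ∷ʳ M
  sorts σ sσ≡ =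
    trans (preimage-join σ σ₂ sσ≡ sσ₂≡ (All.++⁻ˡ y₁ y<M) (All.map <⇒≤ (All.++⁻ʳ y₁ y<M)))
          (sym (++-assoc y₁ y₂ [ M ]))
  go : ∀ h → Preimages h y₁ → Preimages h ((y₁ ++ y₂) ∷ʳ M)
  go zero (σ₁ , sσ₁≡ , uniq₁) = σ₁ ++ M ∷ σ₂ , sorts σ₁ sσ₁≡ , unique
    where
    unique : ∀ τ → stackSort τ ≡ (y₁ ++ y₂) ∷ʳ M → τ ≡ σ₁ ++ M ∷ σ₂
    unique τ sτ≡ with preimage-split τ (y₁ ++ y₂) M sτ≡
    ... | L , R , refl , sL++sR≡ =
      let sL≡ = sorted-cut-unique (stackSort L) (stackSort R) e es y₂
                  (proj₂ (sorted-Path L)) (proj₂ (sorted-Path R)) word≡ dyck sL++sR≡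
          sR≡ = ++-cancelˡ y₁ _ _ (trans (cong (_++ stackSort R) (sym sL≡)) sL++sR≡)
      in cong₂ (λ L R → L ++ M ∷ R) (uniq₁ L sL≡) (uniq₂ R sR≡)
  go (suc _) (ρ , ρ′ , sρ≡ , sρ′≡ , ρ≢ρ′) =
    ρ ++ M ∷ σ₂ , ρ′ ++ M ∷ σ₂ , sorts ρ sρ≡ , sorts ρ′ sρ′≡ ,
    λ eq → ρ≢ρ′ (++-cancelʳ (M ∷ σ₂) ρ ρ′ eq)

ascent-at-end : ∀ {h} c cs M → Extremal (c ∷ cs ∷ʳ M) → Path h 0 (word (c ∷ cs ∷ʳ M)) →
  All (_< M) (c ∷ cs) × Path h 1 (wordFrom c cs)
ascent-at-end c cs M ext v
  with Path-ends-down (wordFrom c cs) _ (subst (Path _ 0) (wordFrom-++ c cs M []) v)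
     | last-entry c cs M ext
... | _ , w | inj₁ (y<M , _) = y<M , w
... | step≡D , _ | inj₂ (_ , step≡U) with () ← trans (sym step≡D) step≡U

Classification : ℕ → Set
Classification n = ∀ {h} x → length x ≤ n → Extremal x → Path h 0 (word x) → Preimages h x

-- The word ends with a down step, so M is the largest entry. The rest of the path ends at height 1:
-- if it stays at height ≥ 1, M can be inserted first or last; otherwise every preimage L M R is cut
-- at the last return to height 0.
classify-∷ʳ : ∀ {n h} c cs M → Classification n → length (c ∷ cs) ≤ n →
  Extremal (c ∷ cs ∷ʳ M) → Path h 0 (word (c ∷ cs ∷ʳ M)) → Preimages h (c ∷ cs ∷ʳ M)
classify-∷ʳ {h = h} c cs M classify< |y|≤n ext v with ascent-at-end c cs M ext v
... | y<M , w with Path-last-return w | Extremal-++ (c ∷ cs) ext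
...   | inj₁ (h′ , refl , w′) | ext-y , _ =
  TwoPreimages-∷ʳ c cs y<M (Preimages-sorted h′ (classify< (c ∷ cs) |y|≤n ext-y w′))
...   | inj₂ (p₁ , p₂ , eq , v₁ , v₂) | ext-y , _ with wordFrom-split c cs p₁ U p₂ eq
...     | es , d , ds , refl , refl , _ , refl =
  let ext-y₁ , ext-y₂ = Extremal-++ (c ∷ es) ext-y
      |y₁|≤n , |y₂|≤n = length-++-≤ (c ∷ es) |y|≤n
  in Preimages-at-return h c es (d ∷ ds) y<M eq v₂
       (classify< (c ∷ es) |y₁|≤n ext-y₁ v₁) (classify< (d ∷ ds) |y₂|≤n ext-y₂ v₂)

classify : ∀ n → Classification n
classify n x |x|≤n ext v with reverseView x
classify n .[] _ _ [] | [] = UniquePreimage-[]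
classify n .([] ∷ʳ M) _ _ [] | [] ∶ _ ∶ʳ M = UniquePreimage-[ M ]
classify zero .(c ∷ cs ∷ʳ M) () _ _ | (c ∷ cs) ∶ _ ∶ʳ M
classify (suc n) .(c ∷ cs ∷ʳ M) |x|≤1+n ext v | (c ∷ cs) ∶ _ ∶ʳ M =
  classify-∷ʳ c cs M (classify n) |y|≤n ext v
  where
  |y|≤n : length (c ∷ cs) ≤ n
  |y|≤n = subst (_≤ n) (+-identityʳ _)
                (≤-pred (subst (_≤ suc n) (length-split (c ∷ cs) M []) |x|≤1+n))

-- build lo hi p continues a sequence whose entries so far fill [lo, hi]: an up step appends lo - 1,
-- a down step hi + 1.
build : ℕ → ℕ → List Step → List ℕ
build lo hi [] = []
build lo hi (U ∷ p) = pred lo ∷ build (pred lo) hi p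
build lo hi (D ∷ p) = suc hi ∷ build lo (suc hi) p

-- Starting from 1 + ups p makes the entries exactly 1, …, length p + 1.
fromWord : List Step → List ℕ
fromWord p = suc (ups p) ∷ build (suc (ups p)) (suc (ups p)) p

length-build : ∀ lo hi p → length (build lo hi p) ≡ length p
length-build lo hi [] = refl
length-build lo hi (U ∷ p) = cong suc (length-build _ hi p)
length-build lo hi (D ∷ p) = cong suc (length-build lo _ p)

wordFrom-build : ∀ {x lo hi} p → lo ≤ x → x ≤ hi → ups p < lo → wordFrom x (build lo hi p) ≡ p
wordFrom-build [] _ _ _ = refl
wordFrom-build {lo = suc lo} (U ∷ p) lo<x x≤hi (s≤s ups<lo) =
  cong₂ _∷_ (stepOf-U lo<x)
            (wordFrom-build p ≤-refl (≤-trans (n≤1+n lo) (≤-trans lo<x x≤hi)) ups<lo)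
wordFrom-build (D ∷ p) lo≤x x≤hi ups<lo =
  cong₂ _∷_ (stepOf-D (m≤n⇒m≤1+n x≤hi))
            (wordFrom-build p (≤-trans lo≤x (m≤n⇒m≤1+n x≤hi)) ≤-refl ups<lo)

InRange : ℕ → ℕ → ℕ → Set
InRange lo hi z = lo ≤ z × z ≤ hi

ExtremalAfter-build : ∀ {lo hi a} p → lo ≤ hi → All (InRange lo hi) a → ups p < lo →
  ExtremalAfter a (build lo hi p)
ExtremalAfter-build [] _ _ _ = tt
ExtremalAfter-build {suc lo} {hi} (U ∷ p) lo<hi a∈ (s≤s ups<lo) =
  inj₂ (All.map proj₁ a∈) ,
  ExtremalAfter-build p lo≤hi
    (All.++⁺ (All.map (Product.map₁ (≤-trans (n≤1+n lo))) a∈) ((≤-refl , lo≤hi) ∷ [])) ups<lo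
  where lo≤hi = ≤-trans (n≤1+n lo) lo<hi
ExtremalAfter-build {lo} {hi} (D ∷ p) lo≤hi a∈ ups<lo =
  inj₁ (All.map (s≤s ∘ proj₂) a∈) ,
  ExtremalAfter-build p (m≤n⇒m≤1+n lo≤hi)
    (All.++⁺ (All.map (Product.map₂ m≤n⇒m≤1+n) a∈) ((m≤n⇒m≤1+n lo≤hi , ≤-refl) ∷ []))
    ups<lo

build-range : ∀ {lo hi} p → lo ≤ hi → ups p < lo → All (InRange 1 (hi + downs p)) (build lo hi p)
build-range [] _ _ = []
build-range {suc lo} {hi} (U ∷ p) lo<hi (s≤s ups<lo) =
  (≤-trans (s≤s z≤n) ups<lo , ≤-trans (≤-trans (n≤1+n lo) lo<hi) (m≤m+n hi _)) ∷
  build-range p (≤-trans (n≤1+n lo) lo<hi) ups<lo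
build-range {lo} {hi} (D ∷ p) lo≤hi ups<lo rewrite +-suc hi (downs p) =
  (s≤s z≤n , s≤s (m≤m+n hi _)) ∷ build-range p (m≤n⇒m≤1+n lo≤hi) ups<lo

Extremal-fromWord : ∀ p → Extremal (fromWord p)
Extremal-fromWord p = inj₁ [] , ExtremalAfter-build p ≤-refl ((≤-refl , ≤-refl) ∷ []) ≤-refl

word-fromWord : ∀ p → word (fromWord p) ≡ p
word-fromWord p = wordFrom-build p ≤-refl ≤-refl ≤-refl

IsPerm-fromWord : ∀ p → IsPerm (suc (length p)) (fromWord p)
IsPerm-fromWord p =
  cong suc (length-build _ _ p) ,
  ExtremalAfter-Unique [] (fromWord p) (Extremal-fromWord p) ,
  λ z z∈ → subst (λ n → 1 ≤ z × z ≤ n) (cong suc (ups+downs p)) (All.lookup range z∈)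
  where
  range : All (InRange 1 (suc (ups p) + downs p)) (fromWord p)
  range = (s≤s z≤n , m≤m+n _ _) ∷ build-range p ≤-refl ≤-refl

IsPerm-⊆-oneTo : ∀ {n π} → IsPerm n π → π ⊆ applyUpTo suc n
IsPerm-⊆-oneTo (_ , _ , range) {zero} z∈π with () ← proj₁ (range zero z∈π)
IsPerm-⊆-oneTo (_ , _ , range) {suc i} z∈π = ∈-applyUpTo⁺ suc (proj₂ (range (suc i) z∈π))

IsPerm-⊆ : ∀ {n π π′} → IsPerm n π → IsPerm n π′ → π ⊆ π′
IsPerm-⊆ {n} perm perm′@(|π′|≡n , unique′ , _) z∈π =
  Unique-⊆-exhaustive unique′ (IsPerm-⊆-oneTo perm′)
    (≤-reflexive (trans (length-applyUpTo suc n) (sym |π′|≡n))) (IsPerm-⊆-oneTo perm z∈π)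

>-asym : ∀ {a b} → b < a → ¬ a < b
>-asym b<a a<b = <-asym a<b b<a

module _ {_≺_ : ℕ → ℕ → Set} (≺-asym : ∀ {a b} → a ≺ b → ¬ b ≺ a) where

  top-unique : ∀ y y′ {M M′} → All (_≺ M) y → All (_≺ M′) y′ →
    y ∷ʳ M ⊆ y′ ∷ʳ M′ → y′ ∷ʳ M′ ⊆ y ∷ʳ M → M ≡ M′
  top-unique y y′ y≺M y′≺M′ ⊆′ ⊇′
    with ∈-++⁻ y′ (⊆′ (∈-++⁺ʳ y (here refl))) | ∈-++⁻ y (⊇′ (∈-++⁺ʳ y′ (here refl)))
  ... | inj₂ (here M≡M′) | _ = M≡M′
  ... | _ | inj₂ (here M′≡M) = sym M′≡M
  ... | inj₁ M∈y′ | inj₁ M′∈y =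
    ⊥-elim (≺-asym (All.lookup y′≺M′ M∈y′) (All.lookup y≺M M′∈y))

  below-top : ∀ {y} y′ {M} → All (_≺ M) y → y ∷ʳ M ⊆ y′ ∷ʳ M → y ⊆ y′
  below-top y′ y≺M ⊆′ z∈y with ∈-++⁻ y′ (⊆′ (∈-++⁺ˡ z∈y))
  ... | inj₁ z∈y′ = z∈y′
  ... | inj₂ (here refl) = ⊥-elim (≺-asym (All.lookup y≺M z∈y) (All.lookup y≺M z∈y))

Extremal-word-injective : ∀ {x x′} → Reverse x → Reverse x′ → Extremal x → Extremal x′ →
  x ⊆ x′ → x′ ⊆ x → word x ≡ word x′ → x ≡ x′
Extremal-word-injective [] [] _ _ _ _ _ = refl
Extremal-word-injective [] (ys′ ∶ _ ∶ʳ _) _ _ _ ⊇′ _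
  with () ← ⊇′ (∈-++⁺ʳ ys′ (here refl))
Extremal-word-injective (ys ∶ _ ∶ʳ _) [] _ _ ⊆′ _ _
  with () ← ⊆′ (∈-++⁺ʳ ys (here refl))
Extremal-word-injective ([] ∶ _ ∶ʳ _) ([] ∶ _ ∶ʳ _) _ _ ⊆′ _ _
  with here refl ← ⊆′ (here refl) = refl
Extremal-word-injective ([] ∶ _ ∶ʳ M) ((c′ ∷ cs′) ∶ _ ∶ʳ M′) _ _ _ _ w≡ =
  ⊥-elim ([]≢∷ʳ (wordFrom c′ cs′) _ (trans w≡ (wordFrom-++ c′ cs′ M′ [])))
Extremal-word-injective ((c ∷ cs) ∶ _ ∶ʳ M) ([] ∶ _ ∶ʳ M′) _ _ _ _ w≡ =
  ⊥-elim ([]≢∷ʳ (wordFrom c cs) _ (trans (sym w≡) (wordFrom-++ c cs M [])))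
Extremal-word-injective ((c ∷ cs) ∶ rs ∶ʳ M) ((c′ ∷ cs′) ∶ rs′ ∶ʳ M′) ext ext′ ⊆′ ⊇′ w≡
  with ∷ʳ-injective (wordFrom c cs) (wordFrom c′ cs′)
         (trans (sym (wordFrom-++ c cs M [])) (trans w≡ (wordFrom-++ c′ cs′ M′ [])))
     | last-entry c cs M ext | last-entry c′ cs′ M′ ext′
... | y-w≡ , _ | inj₁ (y<M , _) | inj₁ (y′<M′ , _)
  with refl ← top-unique <-asym (c ∷ cs) (c′ ∷ cs′) y<M y′<M′ ⊆′ ⊇′ =
  cong (_∷ʳ M) (Extremal-word-injective rs rs′ (Extremal-init ext) (Extremal-init ext′)
                  (below-top <-asym (c′ ∷ cs′) y<M ⊆′) (below-top <-asym (c ∷ cs) y′<M′ ⊇′)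
                  y-w≡)
... | y-w≡ , _ | inj₂ (M<y , _) | inj₂ (M′<y′ , _)
  with refl ← top-unique >-asym (c ∷ cs) (c′ ∷ cs′) M<y M′<y′ ⊆′ ⊇′ =
  cong (_∷ʳ M) (Extremal-word-injective rs rs′ (Extremal-init ext) (Extremal-init ext′)
                  (below-top >-asym (c′ ∷ cs′) M<y ⊆′) (below-top >-asym (c ∷ cs) M′<y′ ⊇′)
                  y-w≡)
... | _ , step≡ | inj₁ (_ , s≡D) | inj₂ (_ , s′≡U)
  with () ← trans (sym s≡D) (trans step≡ s′≡U)
... | _ , step≡ | inj₂ (_ , s≡U) | inj₁ (_ , s′≡D)
  with () ← trans (sym s≡U) (trans step≡ s′≡D)

C*factorials : ∀ n k → k ≤ n → (n C k) * (k ! * (n ∸ k) !) ≡ n !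
C*factorials n k k≤n =
  trans (cong (_* (k ! * (n ∸ k) !)) (nCk≡n!/k![n-k]! k≤n)) (m/n*n≡m (k![n∸k]!∣n! k≤n))
  where instance _ = k !* (n ∸ k) !≢0

-- (k + 1) C(n, k + 1) = (n - k) C(n, k), with n = a + b + 1 and k = a: multiply both sides by
-- a! b! and compare with n!.
C-absorption : ∀ a b → suc a * ((a + suc b) C suc a) ≡ suc b * ((a + suc b) C a)
C-absorption a b = *-cancelʳ-≡ _ _ (a ! * b !) (begin
  suc a * X * (a ! * b !)        ≡⟨ solve 4 (λ s X f g → s :* X :* (f :* g) := X :* ((s :* f) :* g))
                                             refl (suc a) X (a !) (b !) ⟩
  X * (suc a ! * b !)            ≡⟨ cong (λ m → X * (suc a ! * m !)) n∸suc-a≡b ⟨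
  X * (suc a ! * (n ∸ suc a) !)  ≡⟨ C*factorials n (suc a) (m<m+n a (s≤s z≤n)) ⟩
  n !                            ≡⟨ C*factorials n a (m≤m+n a (suc b)) ⟨
  Y * (a ! * (n ∸ a) !)          ≡⟨ cong (λ m → Y * (a ! * m !)) (m+n∸m≡n a (suc b)) ⟩
  Y * (a ! * suc b !)            ≡⟨ solve 4 (λ s Y f g → Y :* (f :* (s :* g)) := s :* Y :* (f :* g))
                                             refl (suc b) Y (a !) (b !) ⟩
  suc b * Y * (a ! * b !)        ∎)
  where
  open ≡-Reasoning
  open +-*-Solver
  instance _ = a !* b !≢0
  n = a + suc b
  X = n C suc a
  Y = n C a
  n∸suc-a≡b : n ∸ suc a ≡ b
  n∸suc-a≡b = trans (cong (_∸ suc a) (+-suc a b)) (m+n∸m≡n (suc a) b)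

-- below n u is C(n, u - 1), with the convention C(n, -1) = 0.
below : ℕ → ℕ → ℕ
below n zero = 0
below n (suc u) = n C u

pascal : ∀ n u → below n u + n C u ≡ suc n C u
pascal n zero = refl
pascal n (suc u) = nCk+nC[k+1]≡[n+1]C[k+1] n u

-- ballot h u is the number of paths from height h to 0 with u up steps.
ballot : ℕ → ℕ → ℕ
ballot h zero = 1
ballot zero (suc u) = ballot 1 u
ballot (suc h) (suc u) = ballot (suc (suc h)) u + ballot h (suc u)

ballot-formula : ∀ h u → ballot h u + below (h + 2 * u) u ≡ (h + 2 * u) C u
ballot-formula h zero = refl
ballot-formula zero (suc u) =
  subst (λ n → ballot 1 u + below n (suc u) ≡ n C suc u) (sym 2+2u≡) (begin
    ballot 1 u + suc m C u              ≡⟨ cong (ballot 1 u +_) (pascal m u) ⟨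
    ballot 1 u + (below m u + m C u)    ≡⟨ +-assoc (ballot 1 u) _ _ ⟨
    (ballot 1 u + below m u) + m C u    ≡⟨ cong₂ _+_ (ballot-formula 1 u) C-middle ⟩
    m C u + m C suc u                   ≡⟨ nCk+nC[k+1]≡[n+1]C[k+1] m u ⟩
    suc m C suc u                       ∎)
  where
  open ≡-Reasoning
  open +-*-Solver
  m = suc (2 * u)
  2+2u≡ : 2 * suc u ≡ suc m
  2+2u≡ = solve 1 (λ u → con 2 :* (con 1 :+ u) := con 1 :+ (con 1 :+ con 2 :* u)) refl u
  m≡ : m ≡ u + suc u
  m≡ = solve 1 (λ u → con 1 :+ con 2 :* u := u :+ (con 1 :+ u)) refl u
  C-middle : m C u ≡ m C suc u
  C-middle = begin
    m C u                ≡⟨ nCk≡nC[n∸k] (≤-trans (m≤m+n u (u + 0)) (n≤1+n _)) ⟩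
    m C (m ∸ u)          ≡⟨ cong (λ n → m C (n ∸ u)) m≡ ⟩
    m C (u + suc u ∸ u)  ≡⟨ cong (m C_) (m+n∸m≡n u (suc u)) ⟩
    m C suc u            ∎
ballot-formula (suc h) (suc u) =
  subst (λ n → ballot (suc h) (suc u) + below n (suc u) ≡ n C suc u) (sym (cong suc N≡)) (begin
    (B₁ + B₂) + suc N C u                      ≡⟨ cong ((B₁ + B₂) +_) (pascal N u) ⟨
    (B₁ + B₂) + (below N u + below N (suc u))  ≡⟨ interchange B₁ B₂ (below N u) (below N (suc u)) ⟩
    (B₁ + below N u) + (B₂ + below N (suc u))  ≡⟨ cong₂ _+_ (ballot-formula (suc (suc h)) u)
                                                   (subst (λ n → B₂ + below n (suc u) ≡ n C suc u) N≡
                                                          (ballot-formula h (suc u))) ⟩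
    N C u + N C suc u                          ≡⟨ nCk+nC[k+1]≡[n+1]C[k+1] N u ⟩
    suc N C suc u                              ∎)
  where
  open ≡-Reasoning
  open +-*-Solver
  N = suc (suc (h + 2 * u))
  B₁ = ballot (suc (suc h)) u
  B₂ = ballot h (suc u)
  N≡ : h + 2 * suc u ≡ N
  N≡ = solve 2 (λ h u → h :+ con 2 :* (con 1 :+ u) := con 2 :+ (h :+ con 2 :* u)) refl h u

below-absorption : ∀ k → suc k * below (2 * k) k ≡ k * ((2 * k) C k)
below-absorption zero = refl
below-absorption (suc j) =
  subst (λ n → suc (suc j) * (n C j) ≡ suc j * (n C suc j)) (sym 2+2j≡) (sym (C-absorption j (suc j)))
  where
  open +-*-Solver
  2+2j≡ : 2 * suc j ≡ j + suc (suc j)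
  2+2j≡ = solve 1 (λ j → con 2 :* (con 1 :+ j) := j :+ (con 2 :+ j)) refl j

catalan≡ballot : ∀ k → catalan k ≡ ballot 0 k
catalan≡ballot k = begin
  central / suc k              ≡⟨ cong (_/ suc k) (sym (+-cancelʳ-≡ (k * central) _ _ absorbed)) ⟩
  suc k * ballot 0 k / suc k   ≡⟨ cong (_/ suc k) (*-comm (suc k) (ballot 0 k)) ⟩
  ballot 0 k * suc k / suc k   ≡⟨ m*n/n≡m (ballot 0 k) (suc k) ⟩
  ballot 0 k                   ∎
  where
  open ≡-Reasoning
  central = (2 * k) C k
  absorbed : suc k * ballot 0 k + k * central ≡ central + k * central
  absorbed = begin
    suc k * ballot 0 k + k * central              ≡⟨ cong (suc k * ballot 0 k +_) (below-absorption k) ⟨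
    suc k * ballot 0 k + suc k * below (2 * k) k  ≡⟨ *-distribˡ-+ (suc k) (ballot 0 k) _ ⟨
    suc k * (ballot 0 k + below (2 * k) k)        ≡⟨ cong (suc k *_) (ballot-formula 0 k) ⟩
    suc k * central                               ∎

BallotPath : ℕ → ℕ → Set
BallotPath h u = Σ (List Step) λ p → Path h 0 p × ups p ≡ u

up∷ : ∀ {h u} → BallotPath (suc h) u → BallotPath h (suc u)
up∷ (p , v , c) = U ∷ p , up v , cong suc c

down∷ : ∀ {h u} → BallotPath h u → BallotPath (suc h) u
down∷ (p , v , c) = D ∷ p , down v , c

encode : ∀ {h u} → BallotPath h u → Fin (ballot h u)
encode {u = zero} _ = Fin.zero
encode {u = suc u} ([] , [] , ())
encode {zero} {suc u} (U ∷ p , up v , c) = encode (p , v , suc-injective c)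
encode {suc h} {suc u} (U ∷ p , up v , c) = encode (p , v , suc-injective c) ↑ˡ ballot h (suc u)
encode {suc h} {suc u} (D ∷ p , down v , c) = ballot (suc (suc h)) u ↑ʳ encode (p , v , c)

encode-irrelevant : ∀ {h u} (x y : BallotPath h u) → proj₁ x ≡ proj₁ y → encode x ≡ encode y
encode-irrelevant (p , v , c) (.p , w , c′) refl
  rewrite Path-irrelevant v w | ≡-irrelevant c c′ = refl

decode : ∀ h u → Fin (ballot h u) → BallotPath h u
decode h zero _ = replicate h D , descent h , ups-descent h
  where
  descent : ∀ h → Path h 0 (replicate h D)
  descent zero = []
  descent (suc h) = down (descent h)
  ups-descent : ∀ h → ups (replicate h D) ≡ 0
  ups-descent zero = refl
  ups-descent (suc h) = ups-descent h
decode zero (suc u) i = up∷ (decode 1 u i)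
decode (suc h) (suc u) i =
  Sum.[ up∷ ∘ decode (suc (suc h)) u , down∷ ∘ decode h (suc u) ]′
    (splitFin (ballot (suc (suc h)) u) i)

decode-encode : ∀ {h u p} (v : Path h 0 p) (c : ups p ≡ u) →
  proj₁ (decode h u (encode (p , v , c))) ≡ p
decode-encode {u = zero} v c = sym (Path-no-ups v c)
decode-encode {u = suc u} [] ()
decode-encode {zero} {suc u} (up v) c = cong (U ∷_) (decode-encode v (suc-injective c))
decode-encode {suc h} {suc u} {U ∷ p} (up v) c
  rewrite splitAt-↑ˡ (ballot (suc (suc h)) u) (encode (p , v , suc-injective c)) (ballot h (suc u)) =
  cong (U ∷_) (decode-encode v (suc-injective c))
decode-encode {suc h} {suc u} {D ∷ p} (down v) c
  rewrite splitAt-↑ʳ (ballot (suc (suc h)) u) (ballot h (suc u)) (encode (p , v , c)) =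
  cong (D ∷_) (decode-encode v c)

encode-decode : ∀ h u i → encode (decode h u i) ≡ i
encode-decode h zero Fin.zero = refl
encode-decode zero (suc u) i =
  trans (encode-irrelevant _ (decode 1 u i) refl) (encode-decode 1 u i)
encode-decode (suc h) (suc u) i =
  Sum.[_,_] {C = λ s → splitFin (ballot (suc (suc h)) u) i ≡ s →
                       encode (Sum.[ up∷ ∘ decode (suc (suc h)) u , down∷ ∘ decode h (suc u) ]′ s) ≡ i}
    (λ j split≡ → trans (cong (_↑ˡ ballot h (suc u))
                               (trans (encode-irrelevant _ (decode (suc (suc h)) u j) refl)
                                      (encode-decode (suc (suc h)) u j)))
                        (splitAt⁻¹-↑ˡ split≡))
    (λ j split≡ → trans (cong (ballot (suc (suc h)) u ↑ʳ_) (encode-decode h (suc u) j))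
                        (splitAt⁻¹-↑ʳ split≡))
    (splitFin (ballot (suc (suc h)) u) i) refl

ups-Dyck : ∀ k {p} → IsDyck k p → ups p ≡ k
ups-Dyck k {p} (|p|≡2k , valid) = *-cancelˡ-≡ (ups p) k 2 (begin
  ups p + (ups p + 0)  ≡⟨ cong (ups p +_) (trans (+-identityʳ (ups p)) ups≡downs) ⟩
  ups p + downs p      ≡⟨ ups+downs p ⟩
  length p             ≡⟨ |p|≡2k ⟩
  2 * k                ∎)
  where
  open ≡-Reasoning
  ups≡downs = Path-ups-downs (valid⇒Path 0 p valid)

BallotPath-Dyck : ∀ k (x : BallotPath 0 k) → IsDyck k (proj₁ x)
BallotPath-Dyck k (p , v , ups≡k) = (begin
  length p         ≡⟨ ups+downs p ⟨
  ups p + downs p  ≡⟨ cong₂ _+_ ups≡k (trans (sym (Path-ups-downs v)) ups≡k) ⟩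
  k + k            ≡⟨ cong (k +_) (+-identityʳ k) ⟨
  2 * k            ∎) , Path⇒valid v
  where open ≡-Reasoning

Dyck↔ballot : ∀ k → Bijection (DyckSetoid k) (FinSetoid (ballot 0 k))
Dyck↔ballot k = record
  { to = to
  ; cong = λ {x} {y} → encode-irrelevant (toBallot x) (toBallot y)
  ; bijective = injective , surjective
  }
  where
  toBallot : Σ (List Step) (IsDyck k) → BallotPath 0 k
  toBallot (p , dyck) = p , valid⇒Path 0 p (proj₂ dyck) , ups-Dyck k {p} dyck
  to : Σ (List Step) (IsDyck k) → Fin (ballot 0 k)
  to = encode ∘ toBallot
  decode-to : ∀ x → proj₁ (decode 0 k (to x)) ≡ proj₁ x
  decode-to (p , dyck) = decode-encode (valid⇒Path 0 p (proj₂ dyck)) (ups-Dyck k {p} dyck)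
  injective : ∀ {x y} → to x ≡ to y → proj₁ x ≡ proj₁ y
  injective {x} {y} to≡ =
    trans (sym (decode-to x)) (trans (cong (proj₁ ∘ decode 0 k) to≡) (decode-to y))
  surjective : ∀ i → ∃ λ x → ∀ {z} → proj₁ z ≡ proj₁ x → to z ≡ i
  surjective i =
    (proj₁ (decode 0 k i) , BallotPath-Dyck k (decode 0 k i)) ,
    λ {z} z≡ → trans (encode-irrelevant (toBallot z) (decode 0 k i) z≡) (encode-decode 0 k i)

2k+1≡ : ∀ k → 2 * k + 1 ≡ suc (2 * k)
2k+1≡ k = +-comm (2 * k) 1

U-Extremal : ∀ {n π} → U-132-312 n π → Extremal π
U-Extremal (((_ , unique , _) , _) , av-132 , av-312) = Avoids⇒Extremal unique av-132 av-312

-- Uniqueness of the preimage forces the path of π to start at height 0.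
word-Dyck : ∀ k π → U-132-312 (2 * k + 1) π → IsDyck k (word π)
word-Dyck k π u@((perm , σ , (_ , sσ≡π) , unique) , _) =
  trans (length-word π) (cong pred (trans (proj₁ perm) (2k+1≡ k))) ,
  Path⇒valid (from-0 h (subst (λ x → Path h 0 (word x)) sσ≡π v))
  where
  h = proj₁ (sorted-Path σ)
  v = proj₂ (sorted-Path σ)
  from-0 : ∀ h → Path h 0 (word π) → Path 0 0 (word π)
  from-0 zero v = v
  from-0 (suc h) v with classify (length π) π ≤-refl (U-Extremal u) v
  ... | τ , τ′ , sτ≡ , sτ′≡ , τ≢τ′ =
    ⊥-elim (τ≢τ′ (trans (unique τ (preimage-IsPerm τ sτ≡ perm) sτ≡)
                        (sym (unique τ′ (preimage-IsPerm τ′ sτ′≡ perm) sτ′≡))))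

fromWord-U : ∀ k p → IsDyck k p → U-132-312 (2 * k + 1) (fromWord p)
fromWord-U k p (|p|≡2k , valid)
  with classify _ (fromWord p) ≤-refl (Extremal-fromWord p)
         (subst (Path 0 0) (sym (word-fromWord p)) (valid⇒Path 0 p valid))
... | σ , sσ≡ , unique =
  (perm , σ , (preimage-IsPerm σ sσ≡ perm , sσ≡) , λ τ _ sτ≡ → unique τ sτ≡) ,
  Extremal⇒Avoids-132 (Extremal-fromWord p) , Extremal⇒Avoids-312 (Extremal-fromWord p)
  where
  perm : IsPerm (2 * k + 1) (fromWord p)
  perm = subst (λ n → IsPerm n (fromWord p)) (trans (cong suc |p|≡2k) (sym (2k+1≡ k)))
               (IsPerm-fromWord p)

word-injective : ∀ {n π π′} → U-132-312 n π → U-132-312 n π′ → word π ≡ word π′ → π ≡ π′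
word-injective {π = π} {π′} u@((perm , _) , _) u′@((perm′ , _) , _) =
  Extremal-word-injective (reverseView π) (reverseView π′) (U-Extremal u) (U-Extremal u′)
    (IsPerm-⊆ perm perm′) (IsPerm-⊆ perm′ perm)

U↔Dyck : ∀ k → Bijection (U132-312-Setoid (2 * k + 1)) (DyckSetoid k)
U↔Dyck k = record
  { to = λ (π , u) → word π , word-Dyck k π u
  ; cong = cong word
  ; bijective = (λ {x} {y} → word-injective (proj₂ x) (proj₂ y))
              , λ (p , dyck) → (fromWord p , fromWord-U k p dyck) ,
                               λ z≡ → trans (cong word z≡) (word-fromWord p)
  }

lemma3p2 : (k : ℕ) →
    Bijection (U132-312-Setoid (2 * k + 1)) (DyckSetoid k) ×
    Bijection (U132-312-Setoid (2 * k + 1)) (FinSetoid (catalan k))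
lemma3p2 k =
  U↔Dyck k ,
  subst (λ m → Bijection (U132-312-Setoid (2 * k + 1)) (FinSetoid m)) (sym (catalan≡ballot k))
        (U↔Dyck k ∘-bijection Dyck↔ballot k)
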